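{- The logic ${\sf BD2}$ is a Logic of Formal Inconsistency and Undeterminedness (LFIU) with respect to the paranormal negation $\neg$ and disjunction $\vee$, where the consistency operator is $\copyright$ and the undeterminedness operator is $\bigstar$, defined by $\bigstar\alpha:=\neg\copyright\copyright\alpha$. That is: (a) $\alpha,\copyright\alpha\not\models_{\sf BD2}\beta$ for some $\alpha,\beta$; (b) $\neg\alpha,\copyright\alpha\not\models_{\sf BD2}\beta$ for some $\alpha,\beta$; (c) $\alpha,\neg\alpha,\copyright\alpha\models_{\sf BD2}\beta$ for all $\alpha,\beta$; (d) $\not\models_{\sf BD2}\alpha\vee\bigstar\alpha$ for some $\alpha$; (e) $\not\models_{\sf BD2}\neg\alpha\vee\bigstar\alpha$ for some $\alpha$; (f) $\models_{\sf BD2}\alpha\vee\neg\alpha\vee\bigstar\alpha$ for all $\alpha$. Moreover, the operator $\text{☆}$, defined by $\text{☆}\alpha:=\copyright\copyright\alpha$, recovers tertium non datur: $\text{☆}\alpha\models_{\sf BD2}\alpha\vee\neg\alpha$ for every $\alpha$.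
   Context: Let $\mathbf 4=\{1,\mathbf b,\mathbf n,0\}$ be the lattice with $0<\mathbf b<1$, $0<\mathbf n<1$ and $\mathbf b,\mathbf n$ incomparable; $\wedge,\vee$ are its meet and join. Over the propositional signature $\{\wedge,\vee,\to,\neg,\copyright\}$ the algebra ${\bf A}_{\sf BD2}$ on $\mathbf 4$ has: $\neg 1=0$, $\neg\mathbf b=\mathbf b$, $\neg\mathbf n=\mathbf n$, $\neg 0=1$; $\copyright 1=1$, $\copyright\mathbf b=0$, $\copyright\mathbf n=\mathbf b$, $\copyright 0=1$; $x\to y=y$ if $x\in\{1,\mathbf b\}$; $0\to y=1$; $\mathbf n\to 1=\mathbf n\to\mathbf n=1$, $\mathbf n\to\mathbf b=\mathbf n\to 0=\mathbf b$. Designated set $D=\{1,\mathbf b\}$. Valuations are homomorphisms from the formula algebra into ${\bf A}_{\sf BD2}$; $\Gamma\models_{\sf BD2}\psi$ iff every valuation designating all of $\Gamma$ designates $\psi$. The negation $\neg$ is paranormal: it is both paraconsistent ($\alpha,\neg\alpha\not\models\beta$ for some $\alpha,\beta$) and paracomplete ($\not\models\beta\vee\neg\beta$ for some $\beta$). -}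

module Defs where

open import Data.Nat using (ℕ)
open import Data.List using (List; []; _∷_)
open import Data.List.Relation.Unary.All using (All)

data V : Set where
  one b n zero : V

-- lattice meet and join (0 < b, n < 1; b, n incomparable)
_⊓_ : V → V → V
one ⊓ y = y
zero ⊓ y = zero
b ⊓ one = b
b ⊓ b = b
b ⊓ n = zero
b ⊓ zero = zero
n ⊓ one = n
n ⊓ b = zero
n ⊓ n = n
n ⊓ zero = zero

_⊔_ : V → V → V
one ⊔ y = one
zero ⊔ y = y
b ⊔ one = one
b ⊔ b = b
b ⊔ n = one
b ⊔ zero = b
n ⊔ one = one
n ⊔ b = one
n ⊔ n = n
n ⊔ zero = n

negV : V → V
negV one = zero
negV b = b
negV n = n
negV zero = one

consV : V → V
consV one = one
consV b = zero
consV n = b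
consV zero = one

impV : V → V → V
impV one y = y
impV b y = y
impV zero y = one
impV n one = one
impV n n = one
impV n b = b
impV n zero = b

data Designated : V → Set where
  des-one : Designated one
  des-b   : Designated b

data Form : Set where
  var  : ℕ → Form
  _∧'_ : Form → Form → Form
  _∨'_ : Form → Form → Form
  _⇒'_ : Form → Form → Form
  ¬'_  : Form → Form
  ©_   : Form → Form

★_ : Form → Form
★ α = ¬' (© (© α))

☆_ : Form → Form
☆ α = © (© α)

-- valuations: homomorphisms from the formula algebra into A_BD2,
-- i.e. unique homomorphic extensions of assignments ℕ → V
Assignment : Set
Assignment = ℕ → V

eval : Assignment → Form → V
eval v (var i) = v i
eval v (α ∧' β) = eval v α ⊓ eval v β
eval v (α ∨' β) = eval v α ⊔ eval v β
eval v (α ⇒' β) = impV (eval v α) (eval v β)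
eval v (¬' α) = negV (eval v α)
eval v (© α) = consV (eval v α)

_⊨_ : List Form → Form → Set
Γ ⊨ ψ = (v : Assignment) → All (λ γ → Designated (eval v γ)) Γ → Designated (eval v ψ)

-- Every claim reduces to the truth tables of A_BD2, since a valuation commutes with
-- the connectives. The value b is the only one at which x and ¬x are both designated,
-- and it is also the only one at which ©x is not; dually, ★x is designated only at n,
-- the only value at which x ∨ ¬x is not, while ☆x is designated exactly off n.
-- The non-consequences are refuted by constant assignments.
module Submission where

open import Defs
open import Data.Empty using (⊥; ⊥-elim)
open import Data.List using ([]; _∷_)
open import Data.List.Relation.Unary.All using (All; []; _∷_)
open import Data.Product using (_×_; ∃-syntax; _,_)
open import Function using (const)
open import Relation.Nullary using (¬_)

zero-undesignated : ¬ Designated zero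
zero-undesignated ()

countermodel⇒⊭ : ∀ {Γ ψ} (v : Assignment) →
                 All (λ γ → Designated (eval v γ)) Γ → ¬ Designated (eval v ψ) → ¬ (Γ ⊨ ψ)
countermodel⇒⊭ v v⊨Γ v⊭ψ Γ⊨ψ = v⊭ψ (Γ⊨ψ v v⊨Γ)

designated-negV-consV-absurd : ∀ x → Designated x → Designated (negV x) → Designated (consV x) → ⊥
designated-negV-consV-absurd one  _  () _
designated-negV-consV-absurd b    _  _  ()
designated-negV-consV-absurd n    () _  _
designated-negV-consV-absurd zero () _  _

designated-⊔-negV-★ : ∀ x → Designated ((x ⊔ negV x) ⊔ negV (consV (consV x)))
designated-⊔-negV-★ one  = des-one
designated-⊔-negV-★ b    = des-b
designated-⊔-negV-★ n    = des-one
designated-⊔-negV-★ zero = des-one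

designated-☆⇒designated-⊔-negV : ∀ x → Designated (consV (consV x)) → Designated (x ⊔ negV x)
designated-☆⇒designated-⊔-negV one  _  = des-one
designated-☆⇒designated-⊔-negV b    _  = des-b
designated-☆⇒designated-⊔-negV n    ()
designated-☆⇒designated-⊔-negV zero _  = des-one

gentle-explosion : ∀ α β → (α ∷ (¬' α) ∷ (© α) ∷ []) ⊨ β
gentle-explosion α β v (⊨α ∷ ⊨¬α ∷ ⊨©α ∷ []) =
  ⊥-elim (designated-negV-consV-absurd (eval v α) ⊨α ⊨¬α ⊨©α)

⊨-excluded-fourth : ∀ α → [] ⊨ ((α ∨' (¬' α)) ∨' (★ α))
⊨-excluded-fourth α v [] = designated-⊔-negV-★ (eval v α)

☆⊨-excluded-middle : ∀ α → ((☆ α) ∷ []) ⊨ (α ∨' (¬' α))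
☆⊨-excluded-middle α v (⊨☆α ∷ []) = designated-☆⇒designated-⊔-negV (eval v α) ⊨☆α

mainTheorem2 :
    (∃[ α ] ∃[ β ] ¬ ((α ∷ (© α) ∷ []) ⊨ β))
    × (∃[ α ] ∃[ β ] ¬ (((¬' α) ∷ (© α) ∷ []) ⊨ β))
    × (∀ α β → (α ∷ (¬' α) ∷ (© α) ∷ []) ⊨ β)
    × (∃[ α ] ¬ ([] ⊨ (α ∨' (★ α))))
    × (∃[ α ] ¬ ([] ⊨ ((¬' α) ∨' (★ α))))
    × (∀ α → [] ⊨ ((α ∨' (¬' α)) ∨' (★ α)))
    × (∀ α → ((☆ α) ∷ []) ⊨ (α ∨' (¬' α)))
mainTheorem2 =
    (p , ¬' p , countermodel⇒⊭ {ψ = ¬' p} (const one) (des-one ∷ des-one ∷ [])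
                               zero-undesignated)
  , (p , p , countermodel⇒⊭ {ψ = p} (const zero) (des-one ∷ des-one ∷ [])
                            zero-undesignated)
  , gentle-explosion
  , (p , countermodel⇒⊭ {ψ = p ∨' (★ p)} (const zero) [] zero-undesignated)
  , (p , countermodel⇒⊭ {ψ = (¬' p) ∨' (★ p)} (const one) [] zero-undesignated)
  , ⊨-excluded-fourth
  , ☆⊨-excluded-middle
  where
  p : Form
  p = var 0
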